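{- Let $\mathbf G$ be a coherent canonical system, $\mathcal S$ a set of sequents and $s$ a sequent. If $\mathcal{S}\vdash^{seq}_{\mathbf G}s$ then $\mathcal{S}\vDash^{seq}_{\mathbf G}s$.
   Context: Syntax. $\mathcal{L}$ is a propositional language with atoms $p_1,p_2,\ldots$ and set of formulas $\mathcal{F}$. A sequent is $\Gamma\Rightarrow E$ with $\Gamma$ a finite set of formulas and $E$ a set of formulas with at most one element. A clause is a sequent of atoms. An $\mathcal{L}$-substitution is a map $\sigma:\mathcal{F}\to\mathcal{F}$ commuting with all connectives, extended pointwise to sets ($\sigma(\emptyset)=\emptyset$). A canonical right-introduction rule for an $n$-ary connective $\diamond$ is $\{\Pi_i\Rightarrow E_i\}_{1\le i\le m}/\ \Rightarrow\diamond(p_1,\dots,p_n)$ with $m\ge0$ and $\Pi_i\cup E_i\subseteq\{p_1,\dots,p_n\}$; an application infers $\Gamma\Rightarrow\sigma(\diamond(p_1,\dots,p_n))$ from $\Gamma,\sigma(\Pi_i)\Rightarrow\sigma(E_i)$ ($1\le i\le m$), for any finite $\Gamma$ and substitution $\sigma$. A canonical left-introduction rule is $\langle\{\Pi_i\Rightarrow E_i\}_{1\le i\le m},\{\Sigma_j\Rightarrow\}_{1\le j\le k}\rangle/\ \diamond(p_1,\dots,p_n)\Rightarrow$ with all atoms among $p_1,\dots,p_n$ (hard premises $\Pi_i\Rightarrow E_i$, soft premises $\Sigma_j\Rightarrow$); an application infers $\Gamma,\sigma(\diamond(p_1,\dots,p_n))\Rightarrow E$ from $\Gamma,\sigma(\Pi_i)\Rightarrow\sigma(E_i)$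 and $\Gamma,\sigma(\Sigma_j)\Rightarrow E$, for any sequent $\Gamma\Rightarrow E$ and substitution $\sigma$. A canonical system has axioms $\varphi\Rightarrow\varphi$, weakening (from $\Gamma\Rightarrow E$ infer $\Gamma,\Delta\Rightarrow E$; from $\Gamma\Rightarrow$ infer $\Gamma\Rightarrow\psi$), cut (from $\Gamma\Rightarrow\varphi$ and $\Delta,\varphi\Rightarrow E$ infer $\Gamma,\Delta\Rightarrow E$), and a set of canonical right- and left-introduction rules. $\mathcal{S}\vdash^{seq}_{\mathbf G}s$ means $s$ is derivable in $\mathbf G$ from the sequents of $\mathcal S$ as extra axioms. Coherence. A classical assignment $u$ satisfies a clause $\Pi\Rightarrow E$ iff $u(p)=f$ for some $p\in\Pi$ or $E=\{q\}$ with $u(q)=t$; $\mathbf G$ is coherent iff for every connective $\diamond$, whenever $\mathbf G$ contains a left rule $\langle S_1,S_2\rangle/\diamond(p_1,\dots,p_n)\Rightarrow$ and a right rule $S_3/\Rightarrow\diamond(p_1,\dots,p_n)$, no assignment satisfies all clauses of $S_1\cup S_2\cup S_3$. Semantics. For $\mathcal{U}$ closed under subformulas, a $\mathcal{U}$-semiframe is $\langle W,\le,v\rangle$ with $(W,\le)$ a nonempty partial order and $v:W\times\mathcal{U}\to\{t,f\}$ persistent ($v(a,\varphi)=t$, $a\le b$ imply $v(b,\varphi)=t$); an $\mathcal{L}$-frame is an $\mathcal{F}$-semiframe. $\Gamma\Rightarrow E$ is locally true at $a$ iff $\Gamma\cup E\subseteq\mathcal{U}$ and either $v(a,\psi)=f$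 for some $\psi\in\Gamma$ or $E=\{\varphi\}$ with $v(a,\varphi)=t$; true at $a$ iff locally true at all $b\ge a$. A semiframe is a model of a sequent iff it is true at every $a$, of a set of sequents iff of each. $\sigma$ (locally) satisfies a clause $\Gamma\Rightarrow E$ at $a$ iff $\sigma(\Gamma)\Rightarrow\sigma(E)$ is (locally) true at $a$. $\sigma$ fulfils a right rule at $a$ iff it satisfies all premises at $a$; a left rule iff it satisfies every hard premise at $a$ and locally satisfies every soft premise at $a$. A semiframe respects a rule $r$ for $\diamond$ iff for all $a$ and $\sigma$: if $\sigma$ fulfils $r$ at $a$ and $\sigma(\diamond(p_1,\dots,p_n))\in\mathcal U$ then $\sigma$ locally satisfies the conclusion of $r$ at $a$. It is $\mathbf G$-legal iff it respects all canonical rules of $\mathbf G$. $\mathcal{S}\vDash^{seq}_{\mathbf G}s$ iff every $\mathbf G$-legal $\mathcal{L}$-frame that is a model of $\mathcal S$ is a model of $s$. -}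

module Defs where

open import Data.Nat using (ℕ)
open import Data.Fin using (Fin; toℕ)
open import Data.Bool using (Bool; true; false)
open import Data.List using (List; []; _∷_; _++_; map)
open import Data.List.Relation.Unary.All using (All)
open import Data.List.Relation.Unary.Any using (Any)
open import Data.List.Membership.Propositional using (_∈_)
open import Data.Maybe using (Maybe; just; nothing)
open import Data.Vec using (Vec; tabulate) renaming ([] to []ᵛ; _∷_ to _∷ᵛ_)
open import Data.Product using (_×_; Σ; ∃)
open import Data.Sum using (_⊎_)
open import Data.Empty using (⊥)
open import Relation.Nullary using (¬_)
open import Relation.Binary.PropositionalEquality using (_≡_)
open import Relation.Binary.Structures using (IsPartialOrder)

-- A propositional language: a type of connectives, each with an arity.
-- Atoms are p_1, p_2, ... represented as  atom 0, atom 1, ...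
record Language : Set₁ where
  field
    Con : Set
    arity : Con → ℕ

module WithLang (L : Language) where
  open Language L

  data Formula : Set where
    atom : ℕ → Formula
    app  : (c : Con) → Vec Formula (arity c) → Formula

  -- An L-substitution commutes with all connectives, hence is determined
  -- by its values on atoms.
  Subst : Set
  Subst = ℕ → Formula

  mutual
    sub : Subst → Formula → Formula
    sub σ (atom i)  = σ i
    sub σ (app c φs) = app c (subs σ φs)

    subs : ∀ {n} → Subst → Vec Formula n → Vec Formula n
    subs σ []ᵛ = []ᵛ
    subs σ (φ ∷ᵛ φs) = sub σ φ ∷ᵛ subs σ φs

  -- the formula  ◇(p_1,…,p_n)  (p_{i+1} is atom i)
  pat : Con → Formula
  pat c = app c (tabulate (λ i → atom (toℕ i)))

  -- Sequents Γ ⇒ E; Γ is a finite set, represented by a list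
  -- (identified up to having the same members, see rule setEq).
  record Sequent : Set where
    constructor _⇒_
    field
      ante : List Formula
      succ : Maybe Formula

  -- Clauses whose atoms are among p_1,…,p_n (atom i ↦ p_{toℕ i + 1})
  record Clause (n : ℕ) : Set where
    constructor _⇛_
    field
      cante : List (Fin n)
      csucc : Maybe (Fin n)
  open Clause

  instA : ∀ {n} → Subst → List (Fin n) → List Formula
  instA σ Π = map (λ i → σ (toℕ i)) Π

  instM : ∀ {n} → Subst → Maybe (Fin n) → Maybe Formula
  instM σ nothing  = nothing
  instM σ (just i) = just (σ (toℕ i))

  instC : ∀ {n} → Subst → Clause n → Sequent
  instC σ cl = instA σ (cante cl) ⇒ instM σ (csucc cl)

  RightRule : ℕ → Set
  RightRule n = List (Clause n)

  record LeftRule (n : ℕ) : Set where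
    constructor ⟨_,_⟩
    field
      hard : List (Clause n)
      soft : List (List (Fin n))
  open LeftRule public

  -- A canonical system: the sets of canonical right/left rules it contains
  -- (axioms, weakening and cut are built into derivability below).
  record System : Set₁ where
    field
      Rrule : (c : Con) → RightRule (arity c) → Set
      Lrule : (c : Con) → LeftRule (arity c) → Set
  open System public

  SatClause : ∀ {n} → (ℕ → Bool) → Clause n → Set
  SatClause u (Π ⇛ E) = Any (λ p → u (toℕ p) ≡ false) Π ⊎ SatSucc E
    where
      SatSucc : Maybe _ → Set
      SatSucc nothing  = ⊥
      SatSucc (just q) = u (toℕ q) ≡ true

  softClause : ∀ {n} → List (Fin n) → Clause n
  softClause Σ = Σ ⇛ nothing

  Coherent : System → Set
  Coherent G = ∀ (c : Con) (l : LeftRule (arity c)) (r : RightRule (arity c))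
    → Lrule G c l → Rrule G c r
    → ¬ (Σ (ℕ → Bool) λ u →
           All (SatClause u) (hard l ++ map softClause (soft l) ++ r))

  SameSet : List Formula → List Formula → Set
  SameSet Γ Γ' = ∀ φ → (φ ∈ Γ → φ ∈ Γ') × (φ ∈ Γ' → φ ∈ Γ)

  data Deriv (G : System) (S : Sequent → Set) : Sequent → Set where
    ax    : ∀ φ → Deriv G S ((φ ∷ []) ⇒ just φ)
    hyp   : ∀ {s} → S s → Deriv G S s
    setEq : ∀ {Γ Γ' E} → SameSet Γ Γ' → Deriv G S (Γ ⇒ E) → Deriv G S (Γ' ⇒ E)
    weakL : ∀ {Γ E} Δ → Deriv G S (Γ ⇒ E) → Deriv G S ((Γ ++ Δ) ⇒ E)
    weakR : ∀ {Γ} ψ → Deriv G S (Γ ⇒ nothing) → Deriv G S (Γ ⇒ just ψ)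
    cut   : ∀ {Γ Δ E} φ → Deriv G S (Γ ⇒ just φ) → Deriv G S ((φ ∷ Δ) ⇒ E)
          → Deriv G S ((Γ ++ Δ) ⇒ E)
    right : ∀ {c} {r : RightRule (arity c)} → Rrule G c r
          → (σ : Subst) (Γ : List Formula)
          → (∀ {cl} → cl ∈ r →
               Deriv G S ((Γ ++ instA σ (cante cl)) ⇒ instM σ (csucc cl)))
          → Deriv G S (Γ ⇒ just (sub σ (pat c)))
    left  : ∀ {c} {l : LeftRule (arity c)} → Lrule G c l
          → (σ : Subst) (Γ : List Formula) (E : Maybe Formula)
          → (∀ {cl} → cl ∈ hard l →
               Deriv G S ((Γ ++ instA σ (cante cl)) ⇒ instM σ (csucc cl)))
          → (∀ {Σ} → Σ ∈ soft l → Deriv G S ((Γ ++ instA σ Σ) ⇒ E))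
          → Deriv G S ((sub σ (pat c) ∷ Γ) ⇒ E)

  -- Semantics: L-frames (semiframes with U = all formulas)

  record Frame : Set₁ where
    field
      W        : Set
      _≤_      : W → W → Set
      isPO     : IsPartialOrder _≡_ _≤_
      nonempty : W
      v        : W → Formula → Bool
      persist  : ∀ {a b φ} → v a φ ≡ true → a ≤ b → v b φ ≡ true

  module _ (M : Frame) where
    open Frame M

    SuccTrue : W → Maybe Formula → Set
    SuccTrue a nothing  = ⊥
    SuccTrue a (just φ) = v a φ ≡ true

    LocallyTrue : W → Sequent → Set
    LocallyTrue a (Γ ⇒ E) = Any (λ ψ → v a ψ ≡ false) Γ ⊎ SuccTrue a E

    TrueAt : W → Sequent → Set
    TrueAt a s = ∀ b → a ≤ b → LocallyTrue b s

    ModelOf : Sequent → Set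
    ModelOf s = ∀ a → TrueAt a s

    ModelOfSet : (Sequent → Set) → Set
    ModelOfSet S = ∀ s → S s → ModelOf s

    FulfilsR : ∀ {n} → W → Subst → RightRule n → Set
    FulfilsR a σ r = All (λ cl → TrueAt a (instC σ cl)) r

    FulfilsL : ∀ {n} → W → Subst → LeftRule n → Set
    FulfilsL a σ l = All (λ cl → TrueAt a (instC σ cl)) (hard l)
                   × All (λ Σ → LocallyTrue a (instA σ Σ ⇒ nothing)) (soft l)

    RespectsR : (c : Con) → RightRule (arity c) → Set
    RespectsR c r = ∀ a σ → FulfilsR a σ r → LocallyTrue a ([] ⇒ just (sub σ (pat c)))

    RespectsL : (c : Con) → LeftRule (arity c) → Set
    RespectsL c l = ∀ a σ → FulfilsL a σ l → LocallyTrue a ((sub σ (pat c) ∷ []) ⇒ nothing)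

    Legal : System → Set
    Legal G = (∀ c r → Rrule G c r → RespectsR c r)
            × (∀ c l → Lrule G c l → RespectsL c l)

  Entails : System → (Sequent → Set) → Sequent → Set₁
  Entails G S s = ∀ (M : Frame) → Legal M G → ModelOfSet M S → ModelOf M s

-- Soundness needs no coherence.  Every derivable sequent is locally true at every world of
-- a legal model of S.  For a canonical rule with context Γ at a world a: if some formula of
-- Γ is false at a the conclusion holds at a; otherwise Γ is true at a, hence by persistence
-- at every b ≥ a, and the premises with Γ dropped say exactly that σ fulfils the rule at a.
module Submission where

open import Defs
open import Data.Bool using (true; false; _≟_)
open import Data.Bool.Properties using (¬-not)
open import Data.List using (List; []; _∷_; _++_)
open import Data.List.Relation.Unary.Any using (Any; here; there; any?)
import Data.List.Relation.Unary.Any as Any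
open import Data.List.Relation.Unary.Any.Properties using (++⁻; ++⁺ˡ; ++⁺ʳ)
open import Data.List.Relation.Unary.All using (tabulate)
open import Data.List.Relation.Binary.Subset.Propositional.Properties using (Any-resp-⊆)
open import Data.List.Membership.Propositional using (_∈_)
open import Data.Maybe using (just; nothing)
open import Data.Product using (_,_; proj₁; proj₂)
open import Data.Sum using (inj₁; inj₂)
open import Relation.Nullary using (¬_; Dec; yes; no; contradiction)
open import Relation.Binary.PropositionalEquality using (_≡_; refl; sym; trans)
open import Relation.Binary.Structures using (IsPartialOrder)

module Soundness {L : Language} where
  open WithLang L
  open Clause

  module _ (M : Frame) where
    open Frame M

    ≤-refl : ∀ {a} → a ≤ a
    ≤-refl = IsPartialOrder.refl isPO

    Valid : Sequent → Set
    Valid s = ∀ a → LocallyTrue M a s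

    FalseIn : W → List Formula → Set
    FalseIn a Γ = Any (λ ψ → v a ψ ≡ false) Γ

    falseIn? : ∀ a Γ → Dec (FalseIn a Γ)
    falseIn? a = any? (λ ψ → v a ψ ≟ false)

    succTrue? : ∀ a E → Dec (SuccTrue M a E)
    succTrue? a nothing  = no λ ()
    succTrue? a (just φ) = v a φ ≟ true

    false-downward : ∀ {a b ψ} → a ≤ b → v b ψ ≡ false → v a ψ ≡ false
    false-downward {a} {b} {ψ} a≤b vbψ≡f with v a ψ in vaψ
    ... | false = refl
    ... | true  = contradiction (trans (sym (persist vaψ a≤b)) vbψ≡f) λ ()

    drop-context : ∀ {a b} Γ {Π E} → ¬ FalseIn a Γ → a ≤ b →
                   LocallyTrue M b ((Γ ++ Π) ⇒ E) → LocallyTrue M b (Π ⇒ E)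
    drop-context Γ ¬falseΓ a≤b (inj₂ succ) = inj₂ succ
    drop-context Γ ¬falseΓ a≤b (inj₁ false∈Γ++Π) with ++⁻ Γ false∈Γ++Π
    ... | inj₁ false∈Γ = contradiction (Any.map (false-downward a≤b) false∈Γ) ¬falseΓ
    ... | inj₂ false∈Π = inj₁ false∈Π

    ax-valid : ∀ φ → Valid ((φ ∷ []) ⇒ just φ)
    ax-valid φ a with v a φ ≟ true
    ... | yes vaφ≡t = inj₂ vaφ≡t
    ... | no vaφ≢t  = inj₁ (here (¬-not vaφ≢t))

    sameSet-valid : ∀ {Γ Γ' E} → SameSet Γ Γ' → Valid (Γ ⇒ E) → Valid (Γ' ⇒ E)
    sameSet-valid Γ≈Γ' ⊨Γ a with ⊨Γ a
    ... | inj₁ falseΓ = inj₁ (Any-resp-⊆ (λ {φ} → proj₁ (Γ≈Γ' φ)) falseΓ)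
    ... | inj₂ succ   = inj₂ succ

    weakL-valid : ∀ {Γ E} Δ → Valid (Γ ⇒ E) → Valid ((Γ ++ Δ) ⇒ E)
    weakL-valid Δ ⊨Γ a with ⊨Γ a
    ... | inj₁ falseΓ = inj₁ (++⁺ˡ falseΓ)
    ... | inj₂ succ   = inj₂ succ

    weakR-valid : ∀ {Γ} ψ → Valid (Γ ⇒ nothing) → Valid (Γ ⇒ just ψ)
    weakR-valid ψ ⊨Γ a with ⊨Γ a
    ... | inj₁ falseΓ = inj₁ falseΓ

    cut-valid : ∀ {Γ Δ E} φ → Valid (Γ ⇒ just φ) → Valid ((φ ∷ Δ) ⇒ E) →
                Valid ((Γ ++ Δ) ⇒ E)
    cut-valid {Γ} φ ⊨φ ⊨φΔ a with ⊨φ a | ⊨φΔ a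
    ... | inj₁ falseΓ | _                   = inj₁ (++⁺ˡ falseΓ)
    ... | inj₂ vaφ≡t  | inj₁ (here vaφ≡f)   = contradiction (trans (sym vaφ≡t) vaφ≡f) λ ()
    ... | inj₂ _      | inj₁ (there falseΔ) = inj₁ (++⁺ʳ Γ falseΔ)
    ... | inj₂ _      | inj₂ succ           = inj₂ succ

    PremiseValid : Subst → List Formula → ∀ {n} → Clause n → Set
    PremiseValid σ Γ cl = Valid ((Γ ++ instA σ (cante cl)) ⇒ instM σ (csucc cl))

    premise-true : ∀ {a σ Γ n} {cl : Clause n} → ¬ FalseIn a Γ →
                   PremiseValid σ Γ cl → TrueAt M a (instC σ cl)
    premise-true {Γ = Γ} ¬falseΓ ⊨cl b a≤b = drop-context Γ ¬falseΓ a≤b (⊨cl b)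

    right-valid : ∀ {c r} → RespectsR M c r → ∀ σ Γ →
                  (∀ {cl} → cl ∈ r → PremiseValid σ Γ cl) →
                  Valid (Γ ⇒ just (sub σ (pat c)))
    right-valid respects σ Γ ⊨prem a with falseIn? a Γ
    ... | yes falseΓ = inj₁ falseΓ
    ... | no ¬falseΓ with respects a σ (tabulate λ cl∈r → premise-true ¬falseΓ (⊨prem cl∈r))
    ... | inj₂ succ = inj₂ succ

    left-valid : ∀ {c l} → RespectsL M c l → ∀ σ Γ E →
                 (∀ {cl} → cl ∈ hard l → PremiseValid σ Γ cl) →
                 (∀ {Σ} → Σ ∈ soft l → Valid ((Γ ++ instA σ Σ) ⇒ E)) →
                 Valid ((sub σ (pat c) ∷ Γ) ⇒ E)
    left-valid respects σ Γ E ⊨hard ⊨soft a with falseIn? a Γ | succTrue? a E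
    ... | yes falseΓ | _        = inj₁ (there falseΓ)
    ... | no _       | yes succ = inj₂ succ
    ... | no ¬falseΓ | no ¬succ
      with respects a σ (tabulate (λ cl∈hard → premise-true ¬falseΓ (⊨hard cl∈hard))
                        , tabulate (λ Σ∈soft → soft-true (⊨soft Σ∈soft a)))
      where
        soft-true : ∀ {Π} → LocallyTrue M a ((Γ ++ Π) ⇒ E) → LocallyTrue M a (Π ⇒ nothing)
        soft-true ⊨ΓΠ with drop-context Γ ¬falseΓ ≤-refl ⊨ΓΠ
        ... | inj₁ falseΠ = inj₁ falseΠ
        ... | inj₂ succ   = contradiction succ ¬succ
    ... | inj₁ (here vaσc≡f) = inj₁ (here vaσc≡f)

    sound : ∀ {G S s} → Legal M G → ModelOfSet M S → Deriv G S s → Valid s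
    sound legal model (ax φ)              = ax-valid φ
    sound legal model (hyp {s} s∈S) a     = model s s∈S a a ≤-refl
    sound legal model (setEq Γ≈Γ' d)      = sameSet-valid Γ≈Γ' (sound legal model d)
    sound legal model (weakL Δ d)         = weakL-valid Δ (sound legal model d)
    sound legal model (weakR ψ d)         = weakR-valid ψ (sound legal model d)
    sound legal model (cut φ d₁ d₂)       =
      cut-valid φ (sound legal model d₁) (sound legal model d₂)
    sound legal model (right {c} {r} r∈G σ Γ prem) =
      right-valid (proj₁ legal c r r∈G) σ Γ λ cl∈r → sound legal model (prem cl∈r)
    sound legal model (left {c} {l} l∈G σ Γ E hard soft) =
      left-valid (proj₂ legal c l l∈G) σ Γ E
        (λ cl∈hard → sound legal model (hard cl∈hard))
        (λ Σ∈soft → sound legal model (soft Σ∈soft))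

theorem6p1 : (L : Language) → let open WithLang L in
    (G : System) → Coherent G → (S : Sequent → Set) (s : Sequent) →
    Deriv G S s → Entails G S s
theorem6p1 L G _ S s d M legal model a b _ = Soundness.sound M legal model d b
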